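{- Let $W$ be a condensed wall. Every $B_2$ in $W-\{a,b\}$ that is part of a $B_3$ in $W$ (i.e. is the union of two bricks of a $B_3$ in $W$) has a bottleneck vertex among its two branch vertices of degree $3$.
   Context: Condensed wall $W$ of size $r$: vertices $u^j_1,\dots,u^j_{2r}$ ($j\in[r]$), $z_0,\dots,z_r$, $a$, $b$; edges $u^j_ku^j_{k+1}$ ($k<2r$), and for all $i,j\in[r]$ the edges $z_{j-1}u^j_{2i-1}$, $z_ju^j_{2i}$, $au^j_1$, $bu^j_{2r}$, and $z_{i-1}z_i$. The vertices $z_0,\dots,z_r$ are the bottleneck vertices. In the hexagonal tiling of the plane, the elementary $B_2$ is the union of the boundary $6$-cycles of two cells sharing an edge (it has exactly two vertices of degree $3$), and the elementary $B_3$ is the union of the boundary $6$-cycles of three pairwise adjacent cells. A $B_n$ in a graph $H$ is a subgraph isomorphic to a subdivision of the elementary $B_n$; its bricks are the cycles corresponding to the cells, and its branch vertices of degree $3$ are those corresponding to degree-$3$ vertices of the elementary graph. -}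

module Defs where

open import Data.Nat using (ℕ; zero; suc; _*_; _<_)
open import Data.Fin using (Fin; toℕ; inject₁)
  renaming (zero to fzero; suc to fsuc)
open import Data.Product using (Σ; ∃; _×_; _,_; proj₁; proj₂)
open import Data.Sum using (_⊎_)
open import Data.List using (List; []; _∷_; _++_; [_])
open import Data.List.Membership.Propositional using (_∈_)
open import Data.List.Relation.Unary.Linked using (Linked)
open import Data.List.Relation.Unary.Unique.Propositional using (Unique)
open import Relation.Binary.PropositionalEquality using (_≡_; _≢_)

-- The condensed wall W of size r.
-- Indices are 0-based:  u j k  stands for u^{j+1}_{k+1}  (j < r, k < 2r),
-- z t stands for z_t (t ≤ r),  a  and  b  are the two extra vertices.

data WV (r : ℕ) : Set where
  u : Fin r → Fin (2 * r) → WV r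
  z : Fin (suc r) → WV r
  a : WV r
  b : WV r

-- The (undirected) edges of W, listed in one orientation.
data WE (r : ℕ) : WV r → WV r → Set where
  row   : ∀ j (k k′ : Fin (2 * r)) → toℕ k′ ≡ suc (toℕ k) → WE r (u j k) (u j k′)
  -- z_{j-1} u^j_{2i-1}   (0-based: position 2i)
  down  : ∀ j (k : Fin (2 * r)) (i : ℕ) → toℕ k ≡ 2 * i → WE r (z (inject₁ j)) (u j k)
  -- z_j u^j_{2i}         (0-based: position 2i+1)
  up    : ∀ j (k : Fin (2 * r)) (i : ℕ) → toℕ k ≡ suc (2 * i) → WE r (z (fsuc j)) (u j k)
  left  : ∀ j (k : Fin (2 * r)) → toℕ k ≡ 0 → WE r a (u j k)
  right : ∀ j (k : Fin (2 * r)) → suc (toℕ k) ≡ 2 * r → WE r b (u j k)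
  spine : ∀ (i : Fin r) → WE r (z (inject₁ i)) (z (fsuc i))

Adj : (r : ℕ) → WV r → WV r → Set
Adj r x y = WE r x y ⊎ WE r y x

Bottleneck : {r : ℕ} → WV r → Set
Bottleneck {r} v = Σ (Fin (suc r)) λ t → v ≡ z t

-- The elementary B_3: three hexagonal cells around a common vertex c.
-- Cell i is the 6-cycle  c, x i, o i 0, o i 1, o i 2, x (i+1 mod 3).

data BV : Set where
  c : BV
  x : Fin 3 → BV
  o : Fin 3 → Fin 3 → BV

next3 : Fin 3 → Fin 3
next3 fzero = fsuc fzero
next3 (fsuc fzero) = fsuc (fsuc fzero)
next3 (fsuc (fsuc fzero)) = fzero

data BE : Set where
  spoke : Fin 3 → BE
  rim   : Fin 3 → Fin 4 → BE

ends : BE → BV × BV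
ends (spoke i) = c , x i
ends (rim i fzero) = x i , o i fzero
ends (rim i (fsuc fzero)) = o i fzero , o i (fsuc fzero)
ends (rim i (fsuc (fsuc fzero))) = o i (fsuc fzero) , o i (fsuc (fsuc fzero))
ends (rim i (fsuc (fsuc (fsuc fzero)))) = o i (fsuc (fsuc fzero)) , x (next3 i)

InCell : Fin 3 → BE → Set
InCell i (spoke j) = (j ≡ i) ⊎ (j ≡ next3 i)
InCell i (rim j _) = j ≡ i

-- degree-3 vertices of the union of cells i and j (for i ≢ j):
-- the two ends of the shared edge, namely c and the common x k.
Deg3 : Fin 3 → Fin 3 → BV → Set
Deg3 i j p = (p ≡ c) ⊎ Σ (Fin 3) λ k → p ≡ x k × InCell i (spoke k) × InCell j (spoke k)

-- A B_3 in W: a subgraph isomorphic to a subdivision of the elementary B_3,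
-- given by an injective image of the branch vertices and, for each edge of
-- the elementary B_3, a path in W (with list of interior vertices `mid`)
-- joining the images of its ends; paths are internally disjoint and their
-- interiors avoid all branch images.

record B3 (r : ℕ) : Set where
  field
    φ        : BV → WV r
    φ-inj    : ∀ p q → φ p ≡ φ q → p ≡ q
    mid      : BE → List (WV r)
  walk : BE → List (WV r)
  walk e = φ (proj₁ (ends e)) ∷ (mid e ++ [ φ (proj₂ (ends e)) ])
  field
    walk-adj  : ∀ e → Linked (Adj r) (walk e)
    mid-uniq  : ∀ e → Unique (mid e)
    mid-avoid : ∀ e v p → v ∈ mid e → φ p ≢ v
    mid-disj  : ∀ e f v → v ∈ mid e → v ∈ mid f → e ≡ f

  AvoidsAB : Fin 3 → Fin 3 → Set
  AvoidsAB i j = ∀ e → (InCell i e ⊎ InCell j e) → ∀ v → v ∈ walk e → (v ≢ a) × (v ≢ b)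

-- Suppose neither branch vertex of degree 3 of the B₂ formed by cells m and n = next3 m is a
-- bottleneck.  As the B₂ avoids a and b, both are wall vertices u; write Y = φ (x n), C = φ c.
-- The B₂ yields three internally disjoint Y–C paths in W − {a, b}: S along the shared spoke,
-- P round cell m and Q round cell n.  In W − {a, b} a path leaves a row only through one of the
-- two poles of the row (the bottleneck vertices joined to it); two poles cannot serve three
-- disjoint paths, so one path stays in the row of Y and C lies in that row too.  There Y has just three usable neighbours: its two row
-- neighbours and, by parity, a single pole.  A path inside a row never turns back, so the path
-- starting away from C meets a pole; together with the path starting at the pole of Y this
-- uses up both poles.  Hence one of P, Q avoids the poles after its first step and is trapped
-- in the row, where its branch vertex x m or x (next3 n) is flanked by its two row neighbours.
-- In the B₃ that vertex has a third neighbour, in the third cell, off all three paths, and the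
-- wall has no room for it.

module Submission where

open import Defs
open import Data.Nat using (ℕ; suc; _*_; _<_)
open import Data.Nat.Properties
  using (suc-injective; <-trans; <-asym; <-irrefl; ≤-reflexive; 0≢1+n; <-cmp; even≢odd)
open import Data.Fin using (Fin; toℕ; inject₁; #_) renaming (zero to fzero; suc to fsuc)
import Data.Fin as F
open import Data.Fin.Properties using (toℕ-injective; toℕ<n; all?)
open import Data.Product using (Σ; ∃; ∃₂; _×_; _,_; proj₁; proj₂)
import Data.Product as Prod
open import Data.Sum using (_⊎_; inj₁; inj₂)
import Data.Sum as Sum
open import Data.Empty using (⊥; ⊥-elim)
open import Data.List using (List; []; _∷_; _++_; [_]; reverse; _ʳ++_)
open import Data.List.Properties using (++-assoc; ++-ʳ++; ʳ++-defn)
open import Data.List.Membership.Propositional using (_∈_; _∉_; find)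
open import Data.List.Membership.Propositional.Properties using (∈-++⁺ˡ; ∈-++⁺ʳ; ∈-++⁻)
open import Data.List.Relation.Unary.Any using (Any; here; there)
import Data.List.Relation.Unary.Any as Any
open import Data.List.Relation.Unary.All using (All; []; _∷_)
import Data.List.Relation.Unary.All as All
open import Data.List.Relation.Unary.All.Properties using (All¬⇒¬Any)
open import Data.List.Relation.Unary.Any.Properties using (reverse⁺; reverse⁻)
open import Data.List.Relation.Unary.Unique.Propositional.Properties using (++⁺)
open import Data.List.Relation.Binary.Disjoint.Propositional using (Disjoint)
open import Data.List.Relation.Unary.Linked using (Linked; []; [-]; _∷_)
import Data.List.Relation.Unary.Linked as Linked
open import Data.List.Relation.Unary.AllPairs using ([]; _∷_)
open import Data.List.Relation.Unary.Unique.Propositional using (Unique)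
open import Data.List.Relation.Binary.Permutation.Propositional using (↭-sym; ↭⇒↭ₛ)
open import Data.List.Relation.Binary.Permutation.Propositional.Properties using (↭-reverse)
import Data.List.Relation.Binary.Permutation.Setoid.Properties as PermutationProperties
open import Relation.Nullary using (¬_; Dec; yes; no)
open import Relation.Nullary.Decidable using (map′; _×-dec_; _⊎-dec_; ¬?; True; toWitness)
open import Relation.Binary.Definitions using (DecidableEquality)
open import Data.List.Relation.Unary.Unique.DecPropositional using (unique?)
open import Relation.Binary using (tri<; tri≈; tri>)
open import Function using (_∘′_)
open import Relation.Binary.PropositionalEquality using (_≡_; _≢_; refl; sym; trans; cong; subst; setoid)

module _ {A : Set} where

  no-three-in-two : ∀ {p q v₁ v₂ v₃ : A} → v₁ ≡ p ⊎ v₁ ≡ q → v₂ ≡ p ⊎ v₂ ≡ q → v₃ ≡ p ⊎ v₃ ≡ q →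
                    v₁ ≢ v₂ → v₁ ≢ v₃ → v₂ ≢ v₃ → ⊥
  no-three-in-two (inj₁ refl) (inj₁ refl) _           ≢₁₂ _   _   = ≢₁₂ refl
  no-three-in-two (inj₂ refl) (inj₂ refl) _           ≢₁₂ _   _   = ≢₁₂ refl
  no-three-in-two (inj₁ refl) (inj₂ refl) (inj₁ refl) _   ≢₁₃ _   = ≢₁₃ refl
  no-three-in-two (inj₁ refl) (inj₂ refl) (inj₂ refl) _   _   ≢₂₃ = ≢₂₃ refl
  no-three-in-two (inj₂ refl) (inj₁ refl) (inj₁ refl) _   _   ≢₂₃ = ≢₂₃ refl
  no-three-in-two (inj₂ refl) (inj₁ refl) (inj₂ refl) _   ≢₁₃ _   = ≢₁₃ refl

  ++-uncons : ∀ (xs : List A) y ys → ∃₂ λ f pre → xs ++ y ∷ ys ≡ f ∷ pre ++ ys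
  ++-uncons []       y ys = y , [] , refl
  ++-uncons (h ∷ xs) y ys = h , xs ++ [ y ] , cong (h ∷_) (sym (++-assoc xs [ y ] ys))

  Unique-reverse : ∀ {xs : List A} → Unique xs → Unique (reverse xs)
  Unique-reverse {xs} = Unique-resp-↭ (↭⇒↭ₛ (↭-sym (↭-reverse xs)))
    where open PermutationProperties (setoid A) using (Unique-resp-↭)

module _ {A : Set} {R : A → A → Set} where

  Linked-first : ∀ {s t} (M : List A) → Linked R (s ∷ M ++ [ t ]) → ∃ λ v → R s v × (v ∈ M ⊎ v ≡ t)
  Linked-first []      (h ∷ _) = _ , h , inj₂ refl
  Linked-first (_ ∷ _) (h ∷ _) = _ , h , inj₁ (here refl)

  Linked-last : ∀ {s t} (M : List A) → Linked R (s ∷ M ++ [ t ]) → ∃ λ v → R v t × (v ∈ M ⊎ v ≡ s)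
  Linked-last []      (h ∷ _)  = _ , h , inj₂ refl
  Linked-last (_ ∷ M) (_ ∷ lk) with Linked-last M lk
  ... | v , h , inj₁ v∈   = v , h , inj₁ (there v∈)
  ... | v , h , inj₂ refl = v , h , inj₁ (here refl)

  Linked-glue : ∀ {s t} (M : List A) {rs} →
                Linked R (s ∷ M ++ [ t ]) → Linked R (t ∷ rs) → Linked R (s ∷ M ++ t ∷ rs)
  Linked-glue []      (h ∷ [-]) l = h ∷ l
  Linked-glue (_ ∷ M) (h ∷ lk)  l = h ∷ Linked-glue M lk l

  module _ (R-sym : ∀ {x y} → R x y → R y x) where

    Linked-ʳ++ : ∀ {s} (xs : List A) {acc} → Linked R (s ∷ xs) → Linked R (s ∷ acc) → Linked R (xs ʳ++ s ∷ acc)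
    Linked-ʳ++ []       _        l = l
    Linked-ʳ++ (_ ∷ xs) (h ∷ lk) l = Linked-ʳ++ xs lk (R-sym h ∷ l)

    Linked-reverse-walk : ∀ {s t} (M : List A) → Linked R (s ∷ M ++ [ t ]) → Linked R (t ∷ reverse M ++ [ s ])
    Linked-reverse-walk {t = t} M lk =
      subst (Linked R) (trans (++-ʳ++ M) (cong (t ∷_) (ʳ++-defn M))) (Linked-ʳ++ (M ++ [ t ]) lk [-])

module Wall (r : ℕ) where

  Vertex : Set
  Vertex = WV r

  infix 4 _~_
  _~_ : Vertex → Vertex → Set
  _~_ = Adj r

  ~-sym : ∀ {v w} → v ~ w → w ~ v
  ~-sym = Sum.swap

  OffAB : Vertex → Set
  OffAB v = v ≢ a × v ≢ b

  InRow : Fin r → Vertex → Set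
  InRow j v = ∃ λ k → v ≡ u j k

  Pole : Fin r → Vertex → Set
  Pole j v = v ≡ z (inject₁ j) ⊎ v ≡ z (fsuc j)

  pole≢u : ∀ {j v j′ k} → Pole j v → v ≢ u j′ k
  pole≢u (inj₁ refl) ()
  pole≢u (inj₂ refl) ()

  vertex-kind : (v : Vertex) → Bottleneck v ⊎ ¬ OffAB v ⊎ ∃₂ λ j k → v ≡ u j k
  vertex-kind (u j k) = inj₂ (inj₂ (j , k , refl))
  vertex-kind (z t)   = inj₁ (t , refl)
  vertex-kind a       = inj₂ (inj₁ λ off → proj₁ off refl)
  vertex-kind b       = inj₂ (inj₁ λ off → proj₂ off refl)

  Clean : Fin r → Vertex → Set
  Clean j v = OffAB v × ¬ Pole j v

  Succ : Fin (2 * r) → Fin (2 * r) → Set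
  Succ k k′ = toℕ k′ ≡ suc (toℕ k)

  succ-unique : ∀ {k k₁ k₂} → Succ k k₁ → Succ k k₂ → k₁ ≡ k₂
  succ-unique s₁ s₂ = toℕ-injective (trans s₁ (sym s₂))

  pred-unique : ∀ {k k₁ k₂} → Succ k₁ k → Succ k₂ k → k₁ ≡ k₂
  pred-unique s₁ s₂ = toℕ-injective (suc-injective (trans (sym s₁) s₂))

  data Neighbour (j : Fin r) (k : Fin (2 * r)) : Vertex → Set where
    next  : ∀ {k′} → Succ k k′ → Neighbour j k (u j k′)
    prev  : ∀ {k′} → Succ k′ k → Neighbour j k (u j k′)
    pole  : ∀ {w} → Pole j w → Neighbour j k w
    end-a : toℕ k ≡ 0 → Neighbour j k a
    end-b : suc (toℕ k) ≡ 2 * r → Neighbour j k b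

  neighbour : ∀ {j k w} → u j k ~ w → Neighbour j k w
  neighbour (inj₁ (row _ _ _ eq))  = next eq
  neighbour (inj₂ (row _ _ _ eq))  = prev eq
  neighbour (inj₂ (down _ _ _ _))  = pole (inj₁ refl)
  neighbour (inj₂ (up _ _ _ _))    = pole (inj₂ refl)
  neighbour (inj₂ (left _ _ eq))   = end-a eq
  neighbour (inj₂ (right _ _ eq))  = end-b eq

  row-neighbour : ∀ {j k k′} → u j k ~ u j k′ → Succ k k′ ⊎ Succ k′ k
  row-neighbour h with neighbour h
  ... | next s  = inj₁ s
  ... | prev s  = inj₂ s
  ... | pole p  = ⊥-elim (pole≢u p refl)

  z-neighbour-unique : ∀ {j k t t′} → u j k ~ z t → u j k ~ z t′ → t ≡ t′
  z-neighbour-unique (inj₂ (down _ _ _ _))  (inj₂ (down _ _ _ _))  = refl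
  z-neighbour-unique (inj₂ (up _ _ _ _))    (inj₂ (up _ _ _ _))    = refl
  z-neighbour-unique (inj₂ (down _ _ i e))  (inj₂ (up _ _ i′ e′))  = ⊥-elim (even≢odd i i′ (trans (sym e) e′))
  z-neighbour-unique (inj₂ (up _ _ i e))    (inj₂ (down _ _ i′ e′)) = ⊥-elim (even≢odd i′ i (trans (sym e′) e))

  pole-neighbour-unique : ∀ {j k v v′} → u j k ~ v → u j k ~ v′ → Pole j v → Pole j v′ → v ≡ v′
  pole-neighbour-unique h h′ (inj₁ refl) (inj₁ refl) = refl
  pole-neighbour-unique h h′ (inj₂ refl) (inj₂ refl) = refl
  pole-neighbour-unique h h′ (inj₁ refl) (inj₂ refl) = cong z (z-neighbour-unique h h′)
  pole-neighbour-unique h h′ (inj₂ refl) (inj₁ refl) = cong z (z-neighbour-unique h h′)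

  row-or-pole : ∀ {j v w} → v ~ w → InRow j v → OffAB w → InRow j w ⊎ Pole j w
  row-or-pole h (_ , refl) off with neighbour h
  ... | next _  = inj₁ (_ , refl)
  ... | prev _  = inj₁ (_ , refl)
  ... | pole p  = inj₂ p
  ... | end-a _ = ⊥-elim (proj₁ off refl)
  ... | end-b _ = ⊥-elim (proj₂ off refl)

  stays-in-row-or-meets-pole : ∀ {j v l} → Linked _~_ (v ∷ l) → InRow j v → All OffAB l →
                               All (InRow j) l ⊎ Any (Pole j) l
  stays-in-row-or-meets-pole {l = []}    _        _   []           = inj₁ []
  stays-in-row-or-meets-pole {l = _ ∷ _} (h ∷ lk) ρ (off ∷ offs) with row-or-pole h ρ off
  ... | inj₂ p  = inj₂ (here p)
  ... | inj₁ ρ′ = Sum.map (ρ′ ∷_) there (stays-in-row-or-meets-pole lk ρ′ offs)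

  clean-walk-in-row : ∀ {j T} → Linked _~_ T → All (Clean j) T → Any (InRow j) T → All (InRow j) T
  clean-walk-in-row lk cs (here ρ) with stays-in-row-or-meets-pole lk ρ (All.map proj₁ (All.tail cs))
  ... | inj₁ ρs = ρ ∷ ρs
  ... | inj₂ p  = ⊥-elim (All¬⇒¬Any (All.map proj₂ (All.tail cs)) p)
  clean-walk-in-row (h ∷ lk) (cl ∷ cs) (there any) with clean-walk-in-row lk cs any
  ... | ρs@(ρ ∷ _) with row-or-pole (~-sym h) ρ (proj₁ cl)
  ...   | inj₁ ρ′ = ρ′ ∷ ρs
  ...   | inj₂ p  = ⊥-elim (proj₂ cl p)

  rightward-stays-right : ∀ {j k k′ l k″} → Linked _~_ (u j k ∷ u j k′ ∷ l) → Unique (u j k ∷ u j k′ ∷ l) →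
              All (InRow j) l → Succ k k′ → u j k″ ∈ u j k′ ∷ l → toℕ k < toℕ k″
  rightward-stays-right _ _ _ s (here refl) = ≤-reflexive (sym s)
  rightward-stays-right {l = []} _ _ _ _ (there ())
  rightward-stays-right {l = _ ∷ _} (_ ∷ h ∷ lk) (k∉ ∷ un) ((_ , refl) ∷ ρs) s (there mem) with neighbour h
  ... | next s′ = <-trans (≤-reflexive (sym s)) (rightward-stays-right (h ∷ lk) un ρs s′ mem)
  ... | prev s′ = ⊥-elim (All.lookup k∉ (there (here refl)) (cong (u _) (pred-unique s s′)))
  ... | pole p  = ⊥-elim (pole≢u p refl)

  leftward-stays-left : ∀ {j k k′ l k″} → Linked _~_ (u j k ∷ u j k′ ∷ l) → Unique (u j k ∷ u j k′ ∷ l) →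
             All (InRow j) l → Succ k′ k → u j k″ ∈ u j k′ ∷ l → toℕ k″ < toℕ k
  leftward-stays-left _ _ _ s (here refl) = ≤-reflexive (sym s)
  leftward-stays-left {l = []} _ _ _ _ (there ())
  leftward-stays-left {l = _ ∷ _} (_ ∷ h ∷ lk) (k∉ ∷ un) ((_ , refl) ∷ ρs) s (there mem) with neighbour h
  ... | prev s′ = <-trans (leftward-stays-left (h ∷ lk) un ρs s′ mem) (≤-reflexive (sym s))
  ... | next s′ = ⊥-elim (All.lookup k∉ (there (here refl)) (cong (u _) (succ-unique s s′)))
  ... | pole p  = ⊥-elim (pole≢u p refl)

  flanked-has-no-other-neighbour : ∀ {j k kR kL w} → Succ k kR → Succ kL k → u j k ~ w → ¬ Pole j w →
            w ≢ u j kR → w ≢ u j kL → ⊥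
  flanked-has-no-other-neighbour sR sL h ¬pole w≢R w≢L with neighbour h
  ... | next s   = w≢R (cong (u _) (succ-unique s sR))
  ... | prev s   = w≢L (cong (u _) (pred-unique s sL))
  ... | pole p   = ¬pole p
  ... | end-a k0 = 0≢1+n (trans (sym k0) sL)
  ... | end-b k1 = <-irrefl (trans sR k1) (toℕ<n _)

  no-fourth-neighbour : ∀ {j X p s w} → InRow j X → InRow j p → InRow j s → X ~ p → X ~ s → p ≢ s →
                        X ~ w → ¬ Pole j w → w ≢ p → w ≢ s → ⊥
  no-fourth-neighbour (_ , refl) (_ , refl) (_ , refl) X~p X~s p≢s X~w ¬pole w≢p w≢s
    with row-neighbour X~p | row-neighbour X~s
  ... | inj₁ sp | inj₂ ss = flanked-has-no-other-neighbour sp ss X~w ¬pole w≢p w≢s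
  ... | inj₂ sp | inj₁ ss = flanked-has-no-other-neighbour ss sp X~w ¬pole w≢s w≢p
  ... | inj₁ sp | inj₁ ss = p≢s (cong (u _) (succ-unique sp ss))
  ... | inj₂ sp | inj₂ ss = p≢s (cong (u _) (pred-unique sp ss))

  -- Only the fact that C occurs on the path is ever used, not that it comes last.
  record Path (Y C : Vertex) : Set where
    field
      first : Vertex
      rest  : List Vertex

    vertices : List Vertex
    vertices = Y ∷ first ∷ rest

    field
      linked  : Linked _~_ vertices
      unique  : Unique vertices
      off-ab  : All OffAB vertices
      reaches : C ∈ first ∷ rest

  open Path

  record InternallyDisjoint {Y C} (π ρ : Path Y C) : Set where
    constructor meeting-only-at-ends
    field
      meet : ∀ {v} → v ∈ vertices π → v ∈ vertices ρ → v ≡ Y ⊎ v ≡ C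

  open InternallyDisjoint

  InternallyDisjoint-sym : ∀ {Y C} {π ρ : Path Y C} → InternallyDisjoint π ρ → InternallyDisjoint ρ π
  InternallyDisjoint-sym disj = meeting-only-at-ends λ v∈ρ v∈π → meet disj v∈π v∈ρ

  ∉⇒≢ : ∀ {v v′ : Vertex} {l} → v ∉ l → v′ ∈ l → v ≢ v′
  ∉⇒≢ v∉ v′∈ refl = v∉ v′∈

  module _ {Y C} (π : Path Y C) where

    Y∉ : Y ∉ first π ∷ rest π
    Y∉ with unique π
    ... | Y∉′ ∷ _ = All¬⇒¬Any Y∉′

    first∉rest : first π ∉ rest π
    first∉rest with unique π
    ... | _ ∷ f∉ ∷ _ = All¬⇒¬Any f∉

    C≢Y : C ≢ Y
    C≢Y refl = Y∉ (reaches π)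

    first∈ : first π ∈ vertices π
    first∈ = there (here refl)

  firsts-distinct : ∀ {Y C} {π ρ : Path Y C} → InternallyDisjoint π ρ → C ∈ rest ρ → first π ≢ first ρ
  firsts-distinct {π = π} {ρ} disj C∈ eq with meet disj (first∈ π) (there (here eq))
  ... | inj₁ eY = Y∉ π (here (sym eY))
  ... | inj₂ eC = first∉rest ρ (subst (_∈ rest ρ) (trans (sym eC) eq) C∈)

  module _ {jY kY jC kC} {π ρ : Path (u jY kY) (u jC kC)} (disj : InternallyDisjoint π ρ) where

    pole-private : ∀ {j v} → Pole j v → v ∈ vertices π → v ∉ vertices ρ
    pole-private p v∈π v∈ρ = Sum.[ pole≢u p , pole≢u p ] (meet disj v∈π v∈ρ)

    poles-apart : ∀ {j v v′} → Pole j v → v ∈ vertices π → v′ ∈ vertices ρ → v ≢ v′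
    poles-apart p v∈π v′∈ρ refl = pole-private p v∈π v′∈ρ

  ends-in-row-or-meets-pole : ∀ {j kY jC kC} (π : Path (u j kY) (u jC kC)) →
                              jC ≡ j ⊎ Any (Pole j) (first π ∷ rest π)
  ends-in-row-or-meets-pole {kY = kY} π
    with stays-in-row-or-meets-pole (linked π) (kY , refl) (All.tail (off-ab π))
  ... | inj₂ p  = inj₂ p
  ... | inj₁ ρs with All.lookup ρs (reaches π)
  ...   | _ , refl = inj₁ refl

  same-row : ∀ {j kY jC kC} (S P Q : Path (u j kY) (u jC kC)) →
             InternallyDisjoint S P → InternallyDisjoint S Q → InternallyDisjoint P Q → jC ≡ j
  same-row S P Q SP SQ PQ
    with ends-in-row-or-meets-pole S | ends-in-row-or-meets-pole P | ends-in-row-or-meets-pole Q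
  ... | inj₁ e | _      | _      = e
  ... | inj₂ _ | inj₁ e | _      = e
  ... | inj₂ _ | inj₂ _ | inj₁ e = e
  ... | inj₂ aS | inj₂ aP | inj₂ aQ with find aS | find aP | find aQ
  ... | _ , vS∈ , pS | _ , vP∈ , pP | _ , vQ∈ , pQ = ⊥-elim (
    no-three-in-two pS pP pQ (poles-apart SP pS (there vS∈) (there vP∈))
      (poles-apart SQ pS (there vS∈) (there vQ∈)) (poles-apart PQ pP (there vP∈) (there vQ∈)))

  record Witness {Y C} (π : Path Y C) : Set where
    field
      T        : List Vertex
      T-linked : Linked _~_ T
      T⊆rest   : ∀ {v} → v ∈ T → v ∈ rest π
      C∈T      : C ∈ T
      X p s w  : Vertex
      p∈T      : p ∈ T
      X∈T      : X ∈ T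
      s∈T      : s ∈ T
      X~p      : X ~ p
      X~s      : X ~ s
      p≢s      : p ≢ s
      X~w      : X ~ w
      w∉π      : w ∉ vertices π

  open Witness using (w)

  KeptOff : ∀ {Y C} {π : Path Y C} → Witness π → Vertex → Set
  KeptOff {π = π} ω v = v ∉ rest π × w ω ≢ v

  kept-off-by : ∀ {jY kY jC kC j v} {π ρ : Path (u jY kY) (u jC kC)} (ω : Witness π) →
                InternallyDisjoint ρ π → Pole j v → v ∈ vertices ρ → w ω ∉ vertices ρ → KeptOff ω v
  kept-off-by ω disj p v∈ρ w∉ρ = pole-private disj p v∈ρ ∘′ there ∘′ there , ∉⇒≢ w∉ρ v∈ρ

  first-kept-off : ∀ {Y C} {π : Path Y C} (ω : Witness π) → KeptOff ω (first π)
  first-kept-off {π = π} ω = first∉rest π , ∉⇒≢ (Witness.w∉π ω) (first∈ π)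

  -- With both poles of the row kept off the rest of π, the part T of π cannot leave the row,
  -- so X is flanked in the row by p and s and has no room for w.
  kept-off-poles-impossible : ∀ {j kY kC z₁ z₂} {π : Path (u j kY) (u j kC)} (ω : Witness π) →
                              Pole j z₁ → Pole j z₂ → z₁ ≢ z₂ → KeptOff ω z₁ → KeptOff ω z₂ → ⊥
  kept-off-poles-impossible {j} {kC = kC} {z₁} {z₂} {π} ω p₁ p₂ z₁≢z₂ (z₁∉ , w≢z₁) (z₂∉ , w≢z₂) =
    no-fourth-neighbour (in-row X∈T) (in-row p∈T) (in-row s∈T) X~p X~s p≢s X~w
      (no-third-pole w≢z₁ w≢z₂) (w≢ p∈T) (w≢ s∈T)
    where
    open Witness ω hiding (w)

    no-third-pole : ∀ {v} → v ≢ z₁ → v ≢ z₂ → ¬ Pole j v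
    no-third-pole v≢z₁ v≢z₂ pv = no-three-in-two p₁ p₂ pv z₁≢z₂ (v≢z₁ ∘′ sym) (v≢z₂ ∘′ sym)

    clean : All (Clean j) T
    clean = All.tabulate λ v∈ →
      All.lookup (off-ab π) (there (there (T⊆rest v∈))) ,
      no-third-pole (λ { refl → z₁∉ (T⊆rest v∈) }) (λ { refl → z₂∉ (T⊆rest v∈) })

    in-row : ∀ {v} → v ∈ T → InRow j v
    in-row = All.lookup (clean-walk-in-row T-linked clean (Any.map (λ eq → kC , sym eq) C∈T))

    w≢ : ∀ {v} → v ∈ T → w ω ≢ v
    w≢ v∈ refl = w∉π (there (there (T⊆rest v∈)))

  -- Far k (Near k): the row neighbour k of kY lies on the side of kY away from (towards) kC.
  record Orientation (j : Fin r) (kY kC : Fin (2 * r)) : Set₁ where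
    field
      Far Near    : Fin (2 * r) → Set
      far-unique  : ∀ {k k′} → Far k → Far k′ → k ≡ k′
      near-unique : ∀ {k k′} → Near k → Near k′ → k ≡ k′
      far-or-near : ∀ {k} → Succ kY k ⊎ Succ k kY → Far k ⊎ Near k
      far-misses  : ∀ {f k l} → Linked _~_ (u j kY ∷ f ∷ l) → Unique (u j kY ∷ f ∷ l) →
                    All (InRow j) l → f ≡ u j k → Far k → u j kC ∉ f ∷ l

  orientation : ∀ {j kY kC} → kY ≢ kC → Orientation j kY kC
  orientation {kY = kY} {kC} kY≢kC with <-cmp (toℕ kC) (toℕ kY)
  ... | tri< kC<kY _ _ = record
    { Far = Succ kY ; Near = λ k → Succ k kY ; far-unique = succ-unique ; near-unique = pred-unique
    ; far-or-near = λ s → s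
    ; far-misses = λ { lk un ρs refl s C∈ → <-asym kC<kY (rightward-stays-right lk un ρs s C∈) } }
  ... | tri≈ _ eq _ = ⊥-elim (kY≢kC (toℕ-injective (sym eq)))
  ... | tri> _ _ kY<kC = record
    { Far = λ k → Succ k kY ; Near = Succ kY ; far-unique = pred-unique ; near-unique = succ-unique
    ; far-or-near = Sum.swap
    ; far-misses = λ { lk un ρs refl s C∈ → <-asym kY<kC (leftward-stays-left lk un ρs s C∈) } }

  module _ {j kY kC} (O : Orientation j kY kC) where
    open Orientation O

    data FirstStep (π : Path (u j kY) (u j kC)) : Set where
      far  : ∀ {k} → first π ≡ u j k → Far k → Any (Pole j) (first π ∷ rest π) → FirstStep π
      near : ∀ {k} → first π ≡ u j k → Near k → FirstStep π
      pole : Pole j (first π) → FirstStep π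

    first-step : (π : Path (u j kY) (u j kC)) → FirstStep π
    first-step π with row-or-pole (Linked.head (linked π)) (kY , refl) (All.head (All.tail (off-ab π)))
    ... | inj₂ p = pole p
    ... | inj₁ (k , eq) with far-or-near (row-neighbour (subst (u j kY ~_) eq (Linked.head (linked π))))
    ...   | inj₂ nr = near eq nr
    ...   | inj₁ fr with stays-in-row-or-meets-pole (Linked.tail (linked π)) (k , eq) (All.tail (All.tail (off-ab π)))
    ...     | inj₁ ρs = ⊥-elim (far-misses (linked π) (unique π) ρs eq fr (reaches π))
    ...     | inj₂ p  = far eq fr (there p)

    no-three-paths-in-row : (S P Q : Path (u j kY) (u j kC)) →
      InternallyDisjoint S P → InternallyDisjoint S Q → InternallyDisjoint P Q →
      (ωP : Witness P) (ωQ : Witness Q) →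
      w ωP ∉ vertices S → w ωP ∉ vertices Q → w ωQ ∉ vertices S → w ωQ ∉ vertices P → ⊥
    no-three-paths-in-row S P Q SP SQ PQ ωP ωQ wP∉S wP∉Q wQ∉S wQ∉P =
      by-kinds (first-step S) (first-step P) (first-step Q)
      where
      C∈restP : u j kC ∈ rest P
      C∈restP = Witness.T⊆rest ωP (Witness.C∈T ωP)

      C∈restQ : u j kC ∈ rest Q
      C∈restQ = Witness.T⊆rest ωQ (Witness.C∈T ωQ)

      PS = InternallyDisjoint-sym SP
      QS = InternallyDisjoint-sym SQ
      QP = InternallyDisjoint-sym PQ

      same-far : ∀ {f f′ k k′} → f ≡ u j k → f′ ≡ u j k′ → Far k → Far k′ → f ≡ f′
      same-far e e′ f f′ = trans e (trans (cong (u j) (far-unique f f′)) (sym e′))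

      same-near : ∀ {f f′ k k′} → f ≡ u j k → f′ ≡ u j k′ → Near k → Near k′ → f ≡ f′
      same-near e e′ n n′ = trans e (trans (cong (u j) (near-unique n n′)) (sym e′))

      same-pole : ∀ (π ρ : Path (u j kY) (u j kC)) → Pole j (first π) → Pole j (first ρ) → first π ≡ first ρ
      same-pole π ρ = pole-neighbour-unique (Linked.head (linked π)) (Linked.head (linked ρ))

      -- Each kind of first step fixes the first vertex, so S, P, Q take the three kinds in some
      -- order.  Then one of P, Q is not the far path, and it keeps off both the pole met by the
      -- far path and the pole entered by the pole path.
      by-kinds : FirstStep S → FirstStep P → FirstStep Q → ⊥
      by-kinds (far e f _) (far e′ f′ _) _ = firsts-distinct SP C∈restP (same-far e e′ f f′)
      by-kinds (near e n)  (near e′ n′)  _ = firsts-distinct SP C∈restP (same-near e e′ n n′)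
      by-kinds (pole p)    (pole p′)     _ = firsts-distinct SP C∈restP (same-pole S P p p′)
      by-kinds (far e f _) _ (far e′ f′ _) = firsts-distinct SQ C∈restQ (same-far e e′ f f′)
      by-kinds (near e n)  _ (near e′ n′)  = firsts-distinct SQ C∈restQ (same-near e e′ n n′)
      by-kinds (pole p)    _ (pole p′)     = firsts-distinct SQ C∈restQ (same-pole S Q p p′)
      by-kinds _ (far e f _) (far e′ f′ _) = firsts-distinct PQ C∈restQ (same-far e e′ f f′)
      by-kinds _ (near e n)  (near e′ n′)  = firsts-distinct PQ C∈restQ (same-near e e′ n n′)
      by-kinds _ (pole p)    (pole p′)     = firsts-distinct PQ C∈restQ (same-pole P Q p p′)
      by-kinds (far _ _ aS) (near _ _) (pole pQ) with find aS
      ... | _ , z∈ , pz = kept-off-poles-impossible ωP pz pQ (poles-apart SQ pz (there z∈) (first∈ Q))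
                            (kept-off-by ωP SP pz (there z∈) wP∉S) (kept-off-by ωP QP pQ (first∈ Q) wP∉Q)
      by-kinds (far _ _ aS) (pole pP) (near _ _) with find aS
      ... | _ , z∈ , pz = kept-off-poles-impossible ωP pz pP (poles-apart SP pz (there z∈) (first∈ P))
                            (kept-off-by ωP SP pz (there z∈) wP∉S) (first-kept-off ωP)
      by-kinds (near _ _) (far _ _ aP) (pole pQ) with find aP
      ... | _ , z∈ , pz = kept-off-poles-impossible ωQ pz pQ (poles-apart PQ pz (there z∈) (first∈ Q))
                            (kept-off-by ωQ PQ pz (there z∈) wQ∉P) (first-kept-off ωQ)
      by-kinds (pole pS) (far _ _ aP) (near _ _) with find aP
      ... | _ , z∈ , pz = kept-off-poles-impossible ωQ pz pS (poles-apart PS pz (there z∈) (first∈ S))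
                            (kept-off-by ωQ PQ pz (there z∈) wQ∉P) (kept-off-by ωQ SQ pS (first∈ S) wQ∉S)
      by-kinds (near _ _) (pole pP) (far _ _ aQ) with find aQ
      ... | _ , z∈ , pz = kept-off-poles-impossible ωP pz pP (poles-apart QP pz (there z∈) (first∈ P))
                            (kept-off-by ωP QP pz (there z∈) wP∉Q) (first-kept-off ωP)
      by-kinds (pole pS) (near _ _) (far _ _ aQ) with find aQ
      ... | _ , z∈ , pz = kept-off-poles-impossible ωP pz pS (poles-apart QS pz (there z∈) (first∈ S))
                            (kept-off-by ωP QP pz (there z∈) wP∉Q) (kept-off-by ωP SP pS (first∈ S) wP∉S)

  no-three-paths : ∀ {Y C jY kY jC kC} → Y ≡ u jY kY → C ≡ u jC kC → (S P Q : Path Y C) →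
    InternallyDisjoint S P → InternallyDisjoint S Q → InternallyDisjoint P Q →
    (ωP : Witness P) (ωQ : Witness Q) →
    w ωP ∉ vertices S → w ωP ∉ vertices Q → w ωQ ∉ vertices S → w ωQ ∉ vertices P → ⊥
  no-three-paths refl refl S P Q SP SQ PQ with same-row S P Q SP SQ PQ
  ... | refl = no-three-paths-in-row (orientation λ kY≡kC → C≢Y S (cong (u _) (sym kY≡kC))) S P Q SP SQ PQ

data Step : Set where
  fwd bwd : BE → Step

edge : Step → BE
edge (fwd e) = e
edge (bwd e) = e

src tgt : Step → BV
src (fwd e) = proj₁ (ends e)
src (bwd e) = proj₂ (ends e)
tgt (fwd e) = proj₂ (ends e)
tgt (bwd e) = proj₁ (ends e)

infixr 5 _▸_
data Trail : BV → BV → Set where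
  stop : ∀ {q} → Trail q q
  _▸_  : ∀ {q} (s : Step) → Trail (tgt s) q → Trail (src s) q

points : ∀ {p q} → Trail p q → List BV
points {p} stop = [ p ]
points (s ▸ t)  = src s ∷ points t

edges : ∀ {p q} → Trail p q → List BE
edges stop    = []
edges (s ▸ t) = edge s ∷ edges t

last∈points : ∀ {p q} (t : Trail p q) → q ∈ points t
last∈points stop    = here refl
last∈points (_ ▸ t) = there (last∈points t)

EndsOnly : BV → BV → List BV → BV → Set
EndsOnly p q ps q′ = q′ ≡ p ⊎ q′ ≡ q ⊎ q′ ∉ ps

record Separate {p q} (t t′ : Trail p q) : Set where
  constructor separate
  field
    shared-points  : All (EndsOnly p q (points t′)) (points t)
    disjoint-edges : All (_∉ edges t′) (edges t)

module Drawing {r} (β : B3 r) where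
  open B3 β
  open Wall r
  open Path using (vertices)

  inner : Step → List Vertex
  inner (fwd e) = mid e
  inner (bwd e) = reverse (mid e)

  beyond : ∀ {p q} → Trail p q → List Vertex
  beyond stop    = []
  beyond (s ▸ t) = inner s ++ φ (tgt s) ∷ beyond t

  verts : ∀ {p q} → Trail p q → List Vertex
  verts {p} t = φ p ∷ beyond t

  ∈-inner⁻ : ∀ s {v} → v ∈ inner s → v ∈ mid (edge s)
  ∈-inner⁻ (fwd e) v∈ = v∈
  ∈-inner⁻ (bwd e) v∈ = reverse⁻ v∈

  ∈-inner⁺ : ∀ s {v} → v ∈ mid (edge s) → v ∈ inner s
  ∈-inner⁺ (fwd e) v∈ = v∈
  ∈-inner⁺ (bwd e) v∈ = reverse⁺ v∈

  inner-unique : ∀ s → Unique (inner s)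
  inner-unique (fwd e) = mid-uniq e
  inner-unique (bwd e) = Unique-reverse (mid-uniq e)

  step-linked : ∀ s → Linked _~_ (φ (src s) ∷ inner s ++ [ φ (tgt s) ])
  step-linked (fwd e) = walk-adj e
  step-linked (bwd e) = Linked-reverse-walk ~-sym (mid e) (walk-adj e)

  verts-linked : ∀ {p q} (t : Trail p q) → Linked _~_ (verts t)
  verts-linked stop    = [-]
  verts-linked (s ▸ t) = Linked-glue (inner s) (step-linked s) (verts-linked t)

  ∈-verts⁻ : ∀ {p q} (t : Trail p q) {v} → v ∈ verts t →
             (∃ λ q′ → q′ ∈ points t × v ≡ φ q′) ⊎ (∃ λ e → e ∈ edges t × v ∈ mid e)
  ∈-verts⁻ stop    (here eq) = inj₁ (_ , here refl , eq)
  ∈-verts⁻ (s ▸ t) (here eq) = inj₁ (_ , here refl , eq)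
  ∈-verts⁻ (s ▸ t) (there v∈) with ∈-++⁻ (inner s) v∈
  ... | inj₁ v∈i = inj₂ (edge s , here refl , ∈-inner⁻ s v∈i)
  ... | inj₂ v∈t = Sum.map (Prod.map₂ (Prod.map₁ there)) (Prod.map₂ (Prod.map₁ there)) (∈-verts⁻ t v∈t)

  ∈-verts⁺ᵖ : ∀ {p q q′} (t : Trail p q) → q′ ∈ points t → φ q′ ∈ verts t
  ∈-verts⁺ᵖ stop    (here refl) = here refl
  ∈-verts⁺ᵖ (s ▸ t) (here refl) = here refl
  ∈-verts⁺ᵖ (s ▸ t) (there q′∈) = there (∈-++⁺ʳ (inner s) (∈-verts⁺ᵖ t q′∈))

  ∈-verts⁺ᵉ : ∀ {p q e v} (t : Trail p q) → e ∈ edges t → v ∈ mid e → v ∈ verts t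
  ∈-verts⁺ᵉ (s ▸ t) (here refl) v∈ = there (∈-++⁺ˡ (∈-inner⁺ s v∈))
  ∈-verts⁺ᵉ (s ▸ t) (there e∈)  v∈ = there (∈-++⁺ʳ (inner s) (∈-verts⁺ᵉ t e∈ v∈))

  verts-unique : ∀ {p q} (t : Trail p q) → Unique (points t) → Unique (edges t) → Unique (verts t)
  verts-unique stop    _            _          = [] ∷ []
  verts-unique (s ▸ t) (src∉ ∷ ups) (e∉ ∷ ues) =
    All.tabulate src-fresh ∷ ++⁺ (inner-unique s) (verts-unique t ups ues) apart
    where
    src-fresh : ∀ {v} → v ∈ inner s ++ verts t → φ (src s) ≢ v
    src-fresh v∈ eq with ∈-++⁻ (inner s) v∈
    ... | inj₁ v∈i = mid-avoid (edge s) _ (src s) (∈-inner⁻ s v∈i) eq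
    ... | inj₂ v∈t with ∈-verts⁻ t v∈t
    ...   | inj₁ (_ , q′∈ , refl) = All.lookup src∉ q′∈ (φ-inj _ _ eq)
    ...   | inj₂ (e , _ , v∈m)    = mid-avoid e _ (src s) v∈m eq

    apart : Disjoint (inner s) (verts t)
    apart (v∈i , v∈t) with ∈-verts⁻ t v∈t
    ... | inj₁ (q′ , _ , refl)  = mid-avoid (edge s) _ q′ (∈-inner⁻ s v∈i) refl
    ... | inj₂ (e , e∈ , v∈m)   = All.lookup e∉ e∈ (mid-disj (edge s) e _ (∈-inner⁻ s v∈i) v∈m)

  src∈walk : ∀ s → φ (src s) ∈ walk (edge s)
  src∈walk (fwd e) = here refl
  src∈walk (bwd e) = there (∈-++⁺ʳ (mid e) (here refl))

  tgt∈walk : ∀ s → φ (tgt s) ∈ walk (edge s)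
  tgt∈walk (fwd e) = there (∈-++⁺ʳ (mid e) (here refl))
  tgt∈walk (bwd e) = here refl

  inner⊆walk : ∀ s {v} → v ∈ inner s → v ∈ walk (edge s)
  inner⊆walk s v∈ = there (∈-++⁺ˡ (∈-inner⁻ s v∈))

  beyond-on-walks : ∀ {p q} (t : Trail p q) {v} → v ∈ beyond t → ∃ λ e → e ∈ edges t × v ∈ walk e
  beyond-on-walks (s ▸ t) v∈ with ∈-++⁻ (inner s) v∈
  ... | inj₁ v∈i         = edge s , here refl , inner⊆walk s v∈i
  ... | inj₂ (here refl) = edge s , here refl , tgt∈walk s
  ... | inj₂ (there v∈t) = Prod.map₂ (Prod.map₁ there) (beyond-on-walks t v∈t)

  verts-on-walks : ∀ {q} s (t : Trail (tgt s) q) {v} → v ∈ verts (s ▸ t) →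
                   ∃ λ e → e ∈ edges (s ▸ t) × v ∈ walk e
  verts-on-walks s t (here refl) = edge s , here refl , src∈walk s
  verts-on-walks s t (there v∈)  = beyond-on-walks (s ▸ t) v∈

  Along : BE → BV → Vertex → Set
  Along e q v = v ∈ mid e ⊎ v ≡ φ q

  leaving : ∀ e → ∃ λ v → φ (proj₁ (ends e)) ~ v × Along e (proj₂ (ends e)) v
  leaving e = Linked-first (mid e) (walk-adj e)

  arriving : ∀ e → ∃ λ v → v ~ φ (proj₂ (ends e)) × Along e (proj₁ (ends e)) v
  arriving e = Linked-last (mid e) (walk-adj e)

  along-∈ : ∀ {p q e q′ v} (t : Trail p q) → Along e q′ v → e ∈ edges t → q′ ∈ points t → v ∈ verts t
  along-∈ t (inj₁ v∈)  e∈ _   = ∈-verts⁺ᵉ t e∈ v∈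
  along-∈ t (inj₂ refl) _ q′∈ = ∈-verts⁺ᵖ t q′∈

  along-∉ : ∀ {p q e q′ v} (t : Trail p q) → Along e q′ v → e ∉ edges t → q′ ∉ points t → v ∉ verts t
  along-∉ t al e∉ q′∉ v∈ with ∈-verts⁻ t v∈ | al
  ... | inj₁ (q″ , _ , refl)    | inj₁ v∈m = mid-avoid _ _ q″ v∈m refl
  ... | inj₁ (_ , q″∈ , refl)   | inj₂ eq  = q′∉ (subst (_∈ points t) (φ-inj _ _ eq) q″∈)
  ... | inj₂ (_ , e′∈ , v∈m′)   | inj₁ v∈m = e∉ (subst (_∈ edges t) (mid-disj _ _ _ v∈m′ v∈m) e′∈)
  ... | inj₂ (e′ , _ , v∈m′)    | inj₂ refl = mid-avoid e′ _ _ v∈m′ refl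

  along-≢ : ∀ {e e′ q q′ v v′} → Along e q v → Along e′ q′ v′ → e ≢ e′ → q ≢ q′ → v ≢ v′
  along-≢ (inj₁ v∈)  (inj₁ v∈′) e≢ _  refl = e≢ (mid-disj _ _ _ v∈ v∈′)
  along-≢ (inj₁ v∈)  (inj₂ refl) _ _  refl = mid-avoid _ _ _ v∈ refl
  along-≢ (inj₂ refl) (inj₁ v∈′) _ _  refl = mid-avoid _ _ _ v∈′ refl
  along-≢ (inj₂ refl) (inj₂ eq)  _ q≢ refl = q≢ (φ-inj _ _ eq)

  module _ {i j} (avoids : AvoidsAB i j) where

    trail-off-ab : ∀ {q} s (t : Trail (tgt s) q) → All (λ e → InCell i e ⊎ InCell j e) (edges (s ▸ t)) →
                   All OffAB (verts (s ▸ t))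
    trail-off-ab s t cells = All.tabulate λ v∈ →
      let e , e∈ , v∈w = verts-on-walks s t v∈ in avoids e (All.lookup cells e∈) _ v∈w

  trail-path : ∀ {q} s (t : Trail (tgt s) q) → Unique (points (s ▸ t)) → Unique (edges (s ▸ t)) →
               All OffAB (verts (s ▸ t)) → Path (φ (src s)) (φ q)
  trail-path {q} s t uniq-pts uniq-eds off =
    let f , pre , eq = ++-uncons (inner s) (φ (tgt s)) (beyond t)
        eq′ = cong (φ (src s) ∷_) eq
    in record
      { first   = f
      ; rest    = pre ++ beyond t
      ; linked  = subst (Linked _~_) eq′ (verts-linked (s ▸ t))
      ; unique  = subst Unique eq′ (verts-unique (s ▸ t) uniq-pts uniq-eds)
      ; off-ab  = subst (All OffAB) eq′ off
      ; reaches = subst (φ q ∈_) eq (∈-++⁺ʳ (inner s) (∈-verts⁺ᵖ t (last∈points t)))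
      }

  trail-path-vertices : ∀ {q} s (t : Trail (tgt s) q) uniq-pts uniq-eds off →
                        vertices (trail-path s t uniq-pts uniq-eds off) ≡ verts (s ▸ t)
  trail-path-vertices s t _ _ _ =
    sym (cong (φ (src s) ∷_) (proj₂ (proj₂ (++-uncons (inner s) (φ (tgt s)) (beyond t)))))

  beyond-in-rest : ∀ {q} s (t : Trail (tgt s) q) uniq-pts uniq-eds off {v} → v ∈ beyond t →
                   v ∈ Path.rest (trail-path s t uniq-pts uniq-eds off)
  beyond-in-rest s t _ _ _ = ∈-++⁺ʳ (proj₁ (proj₂ (++-uncons (inner s) (φ (tgt s)) (beyond t))))

  trails-meet : ∀ {p q} (t t′ : Trail p q) → All (EndsOnly p q (points t′)) (points t) →
                All (_∉ edges t′) (edges t) →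
                ∀ {v} → v ∈ verts t → v ∈ verts t′ → v ≡ φ p ⊎ v ≡ φ q
  trails-meet t t′ pts eds v∈ v∈′ with ∈-verts⁻ t v∈ | ∈-verts⁻ t′ v∈′
  ... | inj₁ (_ , q₁∈ , refl) | inj₁ (_ , q₂∈ , eq) =
    ends-only (All.lookup pts q₁∈) (subst (_∈ points t′) (sym (φ-inj _ _ eq)) q₂∈)
    where
    ends-only : ∀ {p q ps q′} → EndsOnly p q ps q′ → q′ ∈ ps → φ q′ ≡ φ p ⊎ φ q′ ≡ φ q
    ends-only (inj₁ refl)        _   = inj₁ refl
    ends-only (inj₂ (inj₁ refl)) _   = inj₂ refl
    ends-only (inj₂ (inj₂ q′∉))  q′∈ = ⊥-elim (q′∉ q′∈)
  ... | inj₁ (q₁ , _ , refl) | inj₂ (_ , _ , v∈m)  = ⊥-elim (mid-avoid _ _ q₁ v∈m refl)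
  ... | inj₂ (_ , _ , v∈m)   | inj₁ (q₂ , _ , eq)  = ⊥-elim (mid-avoid _ _ q₂ v∈m (sym eq))
  ... | inj₂ (_ , e∈ , v∈m)  | inj₂ (_ , e′∈ , v∈m′) =
    ⊥-elim (All.lookup eds e∈ (subst (_∈ edges t′) (sym (mid-disj _ _ _ v∈m v∈m′)) e′∈))

  separate⇒disjoint : ∀ {p q} {π ρ : Path (φ p) (φ q)} {t t′ : Trail p q} →
                      vertices π ≡ verts t → vertices ρ ≡ verts t′ → Separate t t′ → InternallyDisjoint π ρ
  separate⇒disjoint {t = t} {t′} eπ eρ (separate sp de) =
    meeting-only-at-ends λ {v} v∈π v∈ρ → trails-meet t t′ sp de (subst (v ∈_) eπ v∈π) (subst (v ∈_) eρ v∈ρ)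

  off-path : ∀ {p q e q′ v} (π : Path (φ p) (φ q)) (t : Trail p q) → vertices π ≡ verts t →
             Along e q′ v → e ∉ edges t → q′ ∉ points t → v ∉ vertices π
  off-path {v = v} _ t eq al e∉ q′∉ = along-∉ t al e∉ q′∉ ∘′ subst (v ∈_) eq

_≟ᵥ_ : DecidableEquality BV
c       ≟ᵥ c        = yes refl
c       ≟ᵥ x _      = no λ ()
c       ≟ᵥ o _ _    = no λ ()
x _     ≟ᵥ c        = no λ ()
x i     ≟ᵥ x i′     = map′ (cong x) (λ { refl → refl }) (i F.≟ i′)
x _     ≟ᵥ o _ _    = no λ ()
o _ _   ≟ᵥ c        = no λ ()
o _ _   ≟ᵥ x _      = no λ ()
o i k   ≟ᵥ o i′ k′  = map′ (λ { (refl , refl) → refl }) (λ { refl → refl , refl }) (i F.≟ i′ ×-dec k F.≟ k′)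

_≟ₑ_ : DecidableEquality BE
spoke i   ≟ₑ spoke i′   = map′ (cong spoke) (λ { refl → refl }) (i F.≟ i′)
spoke _   ≟ₑ rim _ _    = no λ ()
rim _ _   ≟ₑ spoke _    = no λ ()
rim i k   ≟ₑ rim i′ k′  = map′ (λ { (refl , refl) → refl }) (λ { refl → refl , refl }) (i F.≟ i′ ×-dec k F.≟ k′)

inCell? : ∀ i e → Dec (InCell i e)
inCell? i (spoke j) = j F.≟ i ⊎-dec j F.≟ next3 i
inCell? i (rim j _) = j F.≟ i

open import Data.List.Membership.DecPropositional _≟ᵥ_ using () renaming (_∈?_ to _∈ᵥ?_)
open import Data.List.Membership.DecPropositional _≟ₑ_ using () renaming (_∈?_ to _∈ₑ?_)

third : Fin 3 → Fin 3
third m = next3 (next3 m)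

record CellTrail (m : Fin 3) {p q} (t : Trail p q) : Set where
  constructor cell-trail
  field
    points-unique : Unique (points t)
    edges-unique  : Unique (edges t)
    in-cells      : All (λ e → InCell m e ⊎ InCell (next3 m) e) (edges t)
    misses-third  : rim (third m) (# 3) ∉ edges t × o (third m) (# 2) ∉ points t ×
                    rim (third m) (# 0) ∉ edges t × o (third m) (# 0) ∉ points t

cell-trail? : ∀ m {p q} (t : Trail p q) → Dec (CellTrail m t)
cell-trail? m t =
  map′ (λ (pu , eu , ic , mt) → cell-trail pu eu ic mt) (λ (cell-trail pu eu ic mt) → pu , eu , ic , mt)
  (unique? _≟ᵥ_ (points t) ×-dec unique? _≟ₑ_ (edges t) ×-dec
   All.all? (λ e → inCell? m e ⊎-dec inCell? (next3 m) e) (edges t) ×-dec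
   ¬? (rim (third m) (# 3) ∈ₑ? edges t) ×-dec ¬? (o (third m) (# 2) ∈ᵥ? points t) ×-dec
   ¬? (rim (third m) (# 0) ∈ₑ? edges t) ×-dec ¬? (o (third m) (# 0) ∈ᵥ? points t))

separate? : ∀ {p q} (t t′ : Trail p q) → Dec (Separate t t′)
separate? {p} {q} t t′ = map′ (λ (sp , de) → separate sp de) (λ (separate sp de) → sp , de)
  (All.all? (λ q′ → q′ ≟ᵥ p ⊎-dec q′ ≟ᵥ q ⊎-dec ¬? (q′ ∈ᵥ? points t′)) (points t) ×-dec
   All.all? (λ e → ¬? (e ∈ₑ? edges t′)) (edges t))

decide-for-all : ∀ {P : Fin 3 → Set} (P? : ∀ m → Dec (P m)) → {True (all? P?)} → ∀ m → P m
decide-for-all P? {ok} = toWitness ok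

spoke-trail : ∀ m → Trail (x (next3 m)) c
spoke-trail m = bwd (spoke (next3 m)) ▸ stop

cell⁻-tail : ∀ m → Trail (o m (# 1)) c
cell⁻-tail m = bwd (rim m (# 1)) ▸ bwd (rim m (# 0)) ▸ bwd (spoke m) ▸ stop

cell⁻ : ∀ m → Trail (x (next3 m)) c
cell⁻ m = bwd (rim m (# 3)) ▸ bwd (rim m (# 2)) ▸ cell⁻-tail m

cell⁺-tail : ∀ n → Trail (o n (# 1)) c
cell⁺-tail n = fwd (rim n (# 2)) ▸ fwd (rim n (# 3)) ▸ bwd (spoke (next3 n)) ▸ stop

cell⁺ : ∀ n → Trail (x n) c
cell⁺ n = fwd (rim n (# 0)) ▸ fwd (rim n (# 1)) ▸ cell⁺-tail n

-- The three trails are finite data; their combinatorics is checked by evaluation for each m.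
spoke-cell-trail : ∀ m → CellTrail m (spoke-trail m)
spoke-cell-trail = decide-for-all λ m → cell-trail? m (spoke-trail m)

cell⁻-cell-trail : ∀ m → CellTrail m (cell⁻ m)
cell⁻-cell-trail = decide-for-all λ m → cell-trail? m (cell⁻ m)

cell⁺-cell-trail : ∀ m → CellTrail m (cell⁺ (next3 m))
cell⁺-cell-trail = decide-for-all λ m → cell-trail? m (cell⁺ (next3 m))

spoke-cell⁻ : ∀ m → Separate (spoke-trail m) (cell⁻ m)
spoke-cell⁻ = decide-for-all λ m → separate? (spoke-trail m) (cell⁻ m)

spoke-cell⁺ : ∀ m → Separate (spoke-trail m) (cell⁺ (next3 m))
spoke-cell⁺ = decide-for-all λ m → separate? (spoke-trail m) (cell⁺ (next3 m))

cell⁻-cell⁺ : ∀ m → Separate (cell⁻ m) (cell⁺ (next3 m))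
cell⁻-cell⁺ = decide-for-all λ m → separate? (cell⁻ m) (cell⁺ (next3 m))

next3-cycle : ∀ m → next3 (third m) ≡ m
next3-cycle fzero               = refl
next3-cycle (fsuc fzero)        = refl
next3-cycle (fsuc (fsuc fzero)) = refl

module SharedSpoke {r} (β : B3 r) (m : Fin 3) (avoids : B3.AvoidsAB β m (next3 m)) where
  open B3 β
  open Wall r
  open Path using (vertices; rest; off-ab; reaches)
  open Drawing β
  open CellTrail

  trail-as-path : ∀ {q} s (t : Trail (tgt s) q) → CellTrail m (s ▸ t) → Path (φ (src s)) (φ q)
  trail-as-path s t σ = trail-path s t (points-unique σ) (edges-unique σ) (trail-off-ab avoids s t (in-cells σ))

  trail-as-path-vertices : ∀ {q} s (t : Trail (tgt s) q) (σ : CellTrail m (s ▸ t)) →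
                           vertices (trail-as-path s t σ) ≡ verts (s ▸ t)
  trail-as-path-vertices s t σ =
    trail-path-vertices s t (points-unique σ) (edges-unique σ) (trail-off-ab avoids s t (in-cells σ))

  beyond-in-rest′ : ∀ {q} s (t : Trail (tgt s) q) (σ : CellTrail m (s ▸ t)) {v} → v ∈ beyond t →
                    v ∈ rest (trail-as-path s t σ)
  beyond-in-rest′ s t σ =
    beyond-in-rest s t (points-unique σ) (edges-unique σ) (trail-off-ab avoids s t (in-cells σ))

  S P Q : Path (φ (x (next3 m))) (φ c)
  S = trail-as-path (bwd (spoke (next3 m))) stop (spoke-cell-trail m)
  P = trail-as-path (bwd (rim m (# 3))) (bwd (rim m (# 2)) ▸ cell⁻-tail m) (cell⁻-cell-trail m)
  Q = trail-as-path (fwd (rim (next3 m) (# 0))) (fwd (rim (next3 m) (# 1)) ▸ cell⁺-tail (next3 m))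
        (cell⁺-cell-trail m)

  S-vertices : vertices S ≡ verts (spoke-trail m)
  S-vertices = trail-as-path-vertices (bwd (spoke (next3 m))) stop (spoke-cell-trail m)

  P-vertices : vertices P ≡ verts (cell⁻ m)
  P-vertices = trail-as-path-vertices (bwd (rim m (# 3))) (bwd (rim m (# 2)) ▸ cell⁻-tail m)
                 (cell⁻-cell-trail m)

  Q-vertices : vertices Q ≡ verts (cell⁺ (next3 m))
  Q-vertices = trail-as-path-vertices (fwd (rim (next3 m) (# 0)))
                 (fwd (rim (next3 m) (# 1)) ▸ cell⁺-tail (next3 m)) (cell⁺-cell-trail m)

  off-all : ∀ {e q v} → Along e q v →
            (∀ {p′ q′} (t : Trail p′ q′) → CellTrail m t → e ∉ edges t × q ∉ points t) →
            v ∉ vertices S × v ∉ vertices P × v ∉ vertices Q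
  off-all {v = v} al misses =
    off S (spoke-trail m) S-vertices (spoke-cell-trail m) ,
    off P (cell⁻ m) P-vertices (cell⁻-cell-trail m) ,
    off Q (cell⁺ (next3 m)) Q-vertices (cell⁺-cell-trail m)
    where
    off : ∀ {p′} (π : Path (φ p′) (φ c)) (t : Trail p′ c) → vertices π ≡ verts t → CellTrail m t → v ∉ vertices π
    off π t eq σ = off-path π t eq al (proj₁ (misses t σ)) (proj₂ (misses t σ))

  SP : InternallyDisjoint S P
  SP = separate⇒disjoint S-vertices P-vertices (spoke-cell⁻ m)

  SQ : InternallyDisjoint S Q
  SQ = separate⇒disjoint S-vertices Q-vertices (spoke-cell⁺ m)

  PQ : InternallyDisjoint P Q
  PQ = separate⇒disjoint P-vertices Q-vertices (cell⁻-cell⁺ m)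

  xm-via-rim : ∃ λ v → φ (x m) ~ v × Along (rim m (# 0)) (o m (# 0)) v
  xm-via-rim = leaving (rim m (# 0))

  xm-via-spoke : ∃ λ v → v ~ φ (x m) × Along (spoke m) c v
  xm-via-spoke = arriving (spoke m)

  xm-via-third : ∃ λ v → v ~ φ (x (next3 (third m))) × Along (rim (third m) (# 3)) (o (third m) (# 2)) v
  xm-via-third = arriving (rim (third m) (# 3))

  xm-via-third-fresh : let v = proj₁ xm-via-third in v ∉ vertices S × v ∉ vertices P × v ∉ vertices Q
  xm-via-third-fresh = off-all (proj₂ (proj₂ xm-via-third))
    λ _ σ → let r3∉ , o2∉ , _ = misses-third σ in r3∉ , o2∉

  P-witness : Witness P
  P-witness = record
    { T        = verts (cell⁻-tail m)
    ; T-linked = verts-linked (cell⁻-tail m)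
    ; T⊆rest   = beyond-in-rest′ (bwd (rim m (# 3))) (bwd (rim m (# 2)) ▸ cell⁻-tail m) (cell⁻-cell-trail m)
                   ∘′ ∈-++⁺ʳ (inner (bwd (rim m (# 2))))
    ; C∈T      = ∈-verts⁺ᵖ (cell⁻-tail m) (last∈points (cell⁻-tail m))
    ; X        = φ (x m)
    ; p        = proj₁ xm-via-rim
    ; s        = proj₁ xm-via-spoke
    ; w        = proj₁ xm-via-third
    ; p∈T      = along-∈ (cell⁻-tail m) (proj₂ (proj₂ xm-via-rim)) (there (here refl)) (there (here refl))
    ; X∈T      = ∈-verts⁺ᵖ (cell⁻-tail m) (there (there (here refl)))
    ; s∈T      = along-∈ (cell⁻-tail m) (proj₂ (proj₂ xm-via-spoke)) (there (there (here refl)))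
                   (there (there (there (here refl))))
    ; X~p      = proj₁ (proj₂ xm-via-rim)
    ; X~s      = ~-sym (proj₁ (proj₂ xm-via-spoke))
    ; p≢s      = along-≢ (proj₂ (proj₂ xm-via-rim)) (proj₂ (proj₂ xm-via-spoke)) (λ ()) (λ ())
    ; X~w      = subst (λ k → φ (x k) ~ proj₁ xm-via-third) (next3-cycle m) (~-sym (proj₁ (proj₂ xm-via-third)))
    ; w∉π      = proj₁ (proj₂ xm-via-third-fresh)
    }

  xp-via-rim : ∃ λ v → v ~ φ (x (third m)) × Along (rim (next3 m) (# 3)) (o (next3 m) (# 2)) v
  xp-via-rim = arriving (rim (next3 m) (# 3))

  xp-via-spoke : ∃ λ v → v ~ φ (x (third m)) × Along (spoke (third m)) c v
  xp-via-spoke = arriving (spoke (third m))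

  xp-via-third : ∃ λ v → φ (x (third m)) ~ v × Along (rim (third m) (# 0)) (o (third m) (# 0)) v
  xp-via-third = leaving (rim (third m) (# 0))

  xp-via-third-fresh : let v = proj₁ xp-via-third in v ∉ vertices S × v ∉ vertices P × v ∉ vertices Q
  xp-via-third-fresh = off-all (proj₂ (proj₂ xp-via-third))
    λ _ σ → let _ , _ , r0∉ , o0∉ = misses-third σ in r0∉ , o0∉

  Q-witness : Witness Q
  Q-witness = record
    { T        = verts (cell⁺-tail (next3 m))
    ; T-linked = verts-linked (cell⁺-tail (next3 m))
    ; T⊆rest   = beyond-in-rest′ (fwd (rim (next3 m) (# 0))) (fwd (rim (next3 m) (# 1)) ▸ cell⁺-tail (next3 m))
                   (cell⁺-cell-trail m) ∘′ ∈-++⁺ʳ (inner (fwd (rim (next3 m) (# 1))))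
    ; C∈T      = ∈-verts⁺ᵖ (cell⁺-tail (next3 m)) (last∈points (cell⁺-tail (next3 m)))
    ; X        = φ (x (third m))
    ; p        = proj₁ xp-via-rim
    ; s        = proj₁ xp-via-spoke
    ; w        = proj₁ xp-via-third
    ; p∈T      = along-∈ (cell⁺-tail (next3 m)) (proj₂ (proj₂ xp-via-rim)) (there (here refl)) (there (here refl))
    ; X∈T      = ∈-verts⁺ᵖ (cell⁺-tail (next3 m)) (there (there (here refl)))
    ; s∈T      = along-∈ (cell⁺-tail (next3 m)) (proj₂ (proj₂ xp-via-spoke)) (there (there (here refl)))
                   (there (there (there (here refl))))
    ; X~p      = ~-sym (proj₁ (proj₂ xp-via-rim))
    ; X~s      = ~-sym (proj₁ (proj₂ xp-via-spoke))
    ; p≢s      = along-≢ (proj₂ (proj₂ xp-via-rim)) (proj₂ (proj₂ xp-via-spoke)) (λ ()) (λ ())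
    ; X~w      = proj₁ (proj₂ xp-via-third)
    ; w∉π      = proj₂ (proj₂ xp-via-third-fresh)
    }

  shared-spoke-bottleneck : Bottleneck (φ c) ⊎ Bottleneck (φ (x (next3 m)))
  shared-spoke-bottleneck with vertex-kind (φ c) | vertex-kind (φ (x (next3 m)))
  ... | inj₁ C-bottleneck | _                    = inj₁ C-bottleneck
  ... | inj₂ _            | inj₁ Y-bottleneck    = inj₂ Y-bottleneck
  ... | inj₂ (inj₁ ¬off)  | inj₂ _               = ⊥-elim (¬off (All.lookup (off-ab S) (there (reaches S))))
  ... | inj₂ (inj₂ _)     | inj₂ (inj₁ ¬off)     = ⊥-elim (¬off (All.head (off-ab S)))
  ... | inj₂ (inj₂ (_ , _ , C-row)) | inj₂ (inj₂ (_ , _ , Y-row)) =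
    ⊥-elim (no-three-paths Y-row C-row S P Q SP SQ PQ P-witness Q-witness
      (proj₁ xm-via-third-fresh) (proj₂ (proj₂ xm-via-third-fresh))
      (proj₁ xp-via-third-fresh) (proj₁ (proj₂ xp-via-third-fresh)))

adjacent-cells : ∀ {i j : Fin 3} → i ≢ j → j ≡ next3 i ⊎ i ≡ next3 j
adjacent-cells {fzero}             {fzero}             i≢j = ⊥-elim (i≢j refl)
adjacent-cells {fzero}             {fsuc fzero}        _   = inj₁ refl
adjacent-cells {fzero}             {fsuc (fsuc fzero)} _   = inj₂ refl
adjacent-cells {fsuc fzero}        {fzero}             _   = inj₂ refl
adjacent-cells {fsuc fzero}        {fsuc fzero}        i≢j = ⊥-elim (i≢j refl)
adjacent-cells {fsuc fzero}        {fsuc (fsuc fzero)} _   = inj₁ refl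
adjacent-cells {fsuc (fsuc fzero)} {fzero}             _   = inj₁ refl
adjacent-cells {fsuc (fsuc fzero)} {fsuc fzero}        _   = inj₂ refl
adjacent-cells {fsuc (fsuc fzero)} {fsuc (fsuc fzero)} i≢j = ⊥-elim (i≢j refl)

pick-branch : ∀ {r} {φ : BV → WV r} {i j p q} → Bottleneck (φ p) ⊎ Bottleneck (φ q) →
              Deg3 i j p → Deg3 i j q → Σ BV λ p′ → Deg3 i j p′ × Bottleneck (φ p′)
pick-branch (inj₁ bp) dp _  = _ , dp , bp
pick-branch (inj₂ bq) _  dq = _ , dq , bq

lemma8 : (r : ℕ) → (β : B3 r) → (i j : Fin 3) → i ≢ j → B3.AvoidsAB β i j →
         Σ BV (λ p → Deg3 i j p × Bottleneck (B3.φ β p))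
lemma8 r β i j i≢j avoids with adjacent-cells i≢j
... | inj₁ refl = pick-branch (SharedSpoke.shared-spoke-bottleneck β i avoids)
                    (inj₁ refl) (inj₂ (next3 i , refl , inj₂ refl , inj₁ refl))
... | inj₂ refl = pick-branch (SharedSpoke.shared-spoke-bottleneck β j (λ e → avoids e ∘′ Sum.swap))
                    (inj₁ refl) (inj₂ (next3 j , refl , inj₁ refl , inj₂ refl))
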